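{- Let $P$ be a standard parabolic subgroup of $\mathrm{GL}_n$ and $C_P$ an isotypic component of $\overline{L}^{\otimes}|_{Z_{M_P}}$. If $P(C_P)={}^wP$ for some $w\in W(C_P)$, then $W(C_P)$ has exactly one element.
   Context: $G=\mathrm{GL}_n$ over a finite field, $T$ diagonal, $B$ upper triangular, $X(T)=\bigoplus\mathbb{Z}e_i$, simple roots $S$, Weyl group $W$; dominance in $X(T)\otimes\mathbb{Q}$ means $\langle\lambda,\alpha\rangle\ge0$ for $\alpha\in S$. For a standard parabolic $P$: Levi $M_P\supseteq T$ with centre $Z_{M_P}$, simple roots $S(P)$, Weyl group $W(P)$; for $w(S(P))\subseteq S$, ${}^wP$ is the standard parabolic with simple roots $w(S(P))$. $\theta_G=\sum_{i=1}^{n-1}(e_1+\dots+e_i)$, $f\ge1$, $\overline{L}^{\otimes}=\bigotimes_{j=1}^f(\bigotimes_{i=1}^{n-1}\bigwedge^i\mathrm{Std})$ as a representation of $f$ copies of $G$, with $Z_{M_P}$ acting diagonally. For the isotypic component $C_P$ associated to $\lambda|_{Z_{M_P}}$, $\lambda\in X(T)$, put $\lambda'=\frac1{|W(P)|}\sum_{w'\in W(P)}w'(\lambda)$; $W(C_P)$ is the set of $w\in W$ with $w(S(P))\subseteq S$ and $w(\lambda')$ dominant; $P(C_P)$ is the standard parabolic with simple roots $w(S(P))\cup\{\alpha\in S:m_\alpha\ne0\}$ where $w\in W(C_P)$ and $f\theta_G-w(\lambda)=\sum_\alpha m_\alpha\alpha$ (independent of choices). -}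

module Defs where

open import Data.Nat as ℕ using (ℕ; zero; suc; _<ᵇ_; _≤ᵇ_; _⊓_; _⊔_; pred)
open import Data.Integer as ℤ using (ℤ; +_)
open import Data.Fin using (Fin; zero; suc; toℕ; inject₁; _≟_)
open import Data.Fin.Subset using (Subset; _∈_; ∣_∣)
open import Data.Fin.Permutation using (Permutation′; _⟨$⟩ʳ_; _⟨$⟩ˡ_)
open import Data.Bool using (Bool; true; false; if_then_else_; _∧_; _∨_; not)
open import Data.Vec using (lookup)
open import Data.Empty using (⊥)
open import Data.Rational.Unnormalised using (ℚᵘ; mkℚᵘ) renaming (_≤_ to _≤ℚ_)
open import Data.Product using (Σ; ∃; _×_)
open import Data.Sum using (_⊎_)
open import Relation.Nullary using (does)
open import Relation.Binary.PropositionalEquality using (_≡_)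

-- G = GL_n with n = suc m (so n ≥ 1).  Coordinates of
-- X(T) = ℤ^n are indexed by Fin n (0-based).  The simple roots are
-- α_k = e_k − e_{k+1} for k : Fin m, i.e. e_(inject₁ k) − e_(suc k).
-- W = S_n = permutations of Fin n, acting by w(e_j) = e_(w j),
-- i.e. (w μ)(i) = μ (w⁻¹ i).

Σℤ : (n : ℕ) → (Fin n → ℤ) → ℤ
Σℤ zero g = + 0
Σℤ (suc n) g = g zero ℤ.+ Σℤ n (λ i → g (suc i))

allF : (n : ℕ) → (Fin n → Bool) → Bool
allF zero g = true
allF (suc n) g = g zero ∧ allF n (λ i → g (suc i))

Σℕ : (n : ℕ) → (Fin n → ℕ) → ℕ
Σℕ zero g = 0
Σℕ (suc n) g = g zero ℕ.+ Σℕ n (λ i → g (suc i))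

Weight : ℕ → Set
Weight n = Fin n → ℤ

e : ∀ {n} → Fin n → Weight n
e i x = if does (i ≟ x) then + 1 else + 0

α : ∀ {m} → Fin m → Weight (suc m)
α k x = e (inject₁ k) x ℤ.- e (suc k) x

Weyl : ℕ → Set
Weyl n = Permutation′ n

act : ∀ {n} {A : Set} → Weyl n → (Fin n → A) → (Fin n → A)
act w μ i = μ (w ⟨$⟩ˡ i)

-- A standard parabolic P of GL_(suc m) is given by its set of simple
-- roots S(P) ⊆ S, as a subset of the index set Fin m.
StdParabolic : ℕ → Set
StdParabolic m = Subset m

-- w(S(P)) ⊆ S
MapsIntoSimple : ∀ {m} → Weyl (suc m) → StdParabolic m → Set
MapsIntoSimple w SP =
  ∀ k → k ∈ SP → toℕ (w ⟨$⟩ʳ suc k) ≡ suc (toℕ (w ⟨$⟩ʳ inject₁ k))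

-- α_k' ∈ w(S(P))   (the simple roots of ^wP, when w(S(P)) ⊆ S)
InImage : ∀ {m} → Weyl (suc m) → StdParabolic m → Fin m → Set
InImage w SP k' = ∃ λ k → k ∈ SP × (w ⟨$⟩ʳ inject₁ k ≡ inject₁ k') × (w ⟨$⟩ʳ suc k ≡ suc k')

Dominant : ∀ {m} → (Fin (suc m) → ℚᵘ) → Set
Dominant μ = ∀ k → μ (suc k) ≤ℚ μ (inject₁ k)

-- i and j lie in the same block of M_P (all simple roots between them in S(P))
sameBlock : ∀ {m} → StdParabolic m → Fin (suc m) → Fin (suc m) → Bool
sameBlock {m} SP i j =
  allF m (λ k → not (((toℕ i ⊓ toℕ j) ≤ᵇ toℕ k) ∧ (toℕ k <ᵇ (toℕ i ⊔ toℕ j))) ∨ lookup SP k)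

-- λ' = (1/|W(P)|) Σ_{w' ∈ W(P)} w'(λ); since W(P) is the group of permutations
-- preserving the blocks of M_P, coordinate i of λ' is the mean of λ over the
-- block containing i.  (mkℚᵘ a b denotes a / (suc b); the block has ≥ 1 element.)
avgP : ∀ {m} → StdParabolic m → Weight (suc m) → Fin (suc m) → ℚᵘ
avgP {m} SP μ i =
  mkℚᵘ (Σℤ (suc m) (λ j → if sameBlock SP i j then μ j else + 0))
       (pred (Σℕ (suc m) (λ j → if sameBlock SP i j then 1 else 0)))

InWC : ∀ {m} → StdParabolic m → Weight (suc m) → Weyl (suc m) → Set
InWC SP μ w = MapsIntoSimple w SP × Dominant (act w (avgP SP μ))

θG : ∀ {m} → Weight (suc m)
θG {m} x = Σℤ m (λ k → Σℤ (suc m) (λ j → if toℕ j ≤ᵇ toℕ k then e j x else + 0))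

eSet : ∀ {n} → Subset n → Weight n
eSet {n} S x = Σℤ n (λ j → if lookup S j then e j x else + 0)

-- μ is a weight of L̄^⊗ = ⊗_{j=1}^f ⊗_{i=1}^{n-1} ∧^i Std (weights of ∧^i Std are
-- the e_S with |S| = i); restricted to T (diagonally).
IsWeightL : ∀ {m} → ℕ → Weight (suc m) → Set
IsWeightL {m} f μ =
  Σ (Fin f → Fin m → Subset (suc m)) λ S →
    (∀ j k → ∣ S j k ∣ ≡ suc (toℕ k)) ×
    (∀ x → μ x ≡ Σℤ f (λ j → Σℤ m (λ k → eSet (S j k) x)))

RootExpansion : ∀ {m} → ℕ → Weyl (suc m) → Weight (suc m) → (Fin m → ℤ) → Set
RootExpansion {m} f w μ c =
  ∀ x → (+ f) ℤ.* θG x ℤ.- act w μ x ≡ Σℤ m (λ k → c k ℤ.* α k x)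

-- α_k is a simple root of P(C_P), computed with w ∈ W(C_P) and coefficients c
InPC : ∀ {m} → StdParabolic m → Weyl (suc m) → (Fin m → ℤ) → Fin m → Set
InPC SP w c k = InImage w SP k ⊎ (c k ≡ + 0 → ⊥)

{-# OPTIONS --safe #-}
module Submission where

-- Let w′ be the element of W(C_P) used to compute P(C_P), and v any element of W(C_P); we show
-- v = w′, i.e. that σ = v w′⁻¹ increases at every pair K, K+1 (then σ = id).  If α_K ∈ w′(S(P)),
-- this holds because v maps S(P) into S.  Otherwise the hypothesis P(C_P) = ^wP, together with
-- |w(S(P))| = |w′(S(P))|, says that the coefficient c_K of α_K in fθ_G − w′(λ) vanishes.  As λ is
-- a sum of weights e_S with |S| = l + 1, c_K is a sum of nonnegative terms, one for each S,
-- comparing w′(S) with {0,…,l} on the coordinates {0,…,K}; so c_K = 0 forces each w′(S) to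
-- contain {0,…,K} (if l ≥ K) or to lie inside it (if l ≤ K).  Hence λ is ≥ A on w′⁻¹{0,…,K} and
-- ≤ A − f on the other coordinates.  The M_P-blocks of w′⁻¹(K) and w′⁻¹(K+1) lie on the
-- respective sides, so λ′ is strictly larger at w′⁻¹(K) than at w′⁻¹(K+1), and dominance of
-- v(λ′) forces v(w′⁻¹(K)) < v(w′⁻¹(K+1)).

open import Defs
open import Data.Nat as ℕ using (ℕ; zero; suc; pred; _≤ᵇ_; _<ᵇ_; _⊓_; _⊔_)
import Data.Nat.Properties as ℕ
open import Data.Integer as ℤ using (ℤ; +_; _+_; _*_; -_; _-_; _≤_; _<_; +≤+; +<+)
open import Data.Integer.Properties hiding (_≟_)
open import Data.Fin as Fin using (Fin; zero; suc; toℕ; inject₁; fromℕ; fromℕ<; lower₁)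
open import Data.Fin.Properties
  using (toℕ-injective; toℕ-inject₁; toℕ<n; toℕ≤pred[n]; toℕ-fromℕ; toℕ-lower₁; inject₁-lower₁)
open import Data.Fin.Induction using (<-weakInduction; >-weakInduction)
open import Data.Fin.Relation.Unary.Top using (view; ‵fromℕ; ‵inject₁)
open import Data.Fin.Subset using (Subset; _∈_; ∣_∣)
open import Data.Fin.Permutation using (_⟨$⟩ʳ_; _⟨$⟩ˡ_; flip; inverseˡ; inverseʳ)
open import Data.Bool using (Bool; true; false; T; not; if_then_else_; _∧_; _∨_)
open import Data.Bool.Properties using (∧-comm; T-≡; T-∧)
open import Data.Vec using (lookup; []; _∷_)
open import Data.Vec.Properties using (lookup⇒[]=; []=⇒lookup)
open import Data.Rational.Unnormalised using (ℚᵘ; mkℚᵘ; *≤*; *<*)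
  renaming (_≤_ to _≤ℚ_; _<_ to _<ℚ_)
import Data.Rational.Unnormalised.Properties as ℚ
open import Data.Unit using (tt)
open import Data.Empty using (⊥-elim)
open import Data.Product using (Σ; _×_; _,_; proj₁; proj₂)
open import Data.Sum using (inj₁; inj₂)
open import Function using (_∘_; _∘′_)
open import Function.Bundles using (_⇔_; Equivalence)
open import Relation.Nullary using (¬_; Dec; yes; no)
open import Relation.Nullary.Decidable using (T?; map′)
open import Relation.Unary using (Pred)
open import Relation.Binary using (Rel; Reflexive; Transitive)
open import Relation.Binary.PropositionalEquality
open import Algebra.Properties.Semiring.Sum +-*-semiring
  using (sum; sum-cong-≗; ∑-distrib-+; ∑-comm; *-distribˡ-sum; sum-permute)
open import Algebra.Properties.CommutativeSemigroup *-commutativeSemigroup using (x∙yz≈y∙xz)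
open import Algebra.Properties.Ring +-*-ring using (x[y-z]≈xy-xz)

𝟙 : Bool → ℤ
𝟙 b = if b then + 1 else + 0

𝟙-nonneg : ∀ b → + 0 ≤ 𝟙 b
𝟙-nonneg true = +≤+ ℕ.z≤n
𝟙-nonneg false = +≤+ ℕ.z≤n

𝟙-mono : ∀ {a b} → (T a → T b) → 𝟙 a ≤ 𝟙 b
𝟙-mono {false} {b} _ = 𝟙-nonneg b
𝟙-mono {true} {true} _ = ≤-refl
𝟙-mono {true} {false} a⇒b = ⊥-elim (a⇒b tt)

𝟙-< : ∀ {a b} → ¬ T a → T b → 𝟙 a < 𝟙 b
𝟙-< {false} {true} _ _ = +<+ (ℕ.s≤s ℕ.z≤n)
𝟙-< {true} ¬a _ = ⊥-elim (¬a tt)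

𝟙-* : ∀ a b → 𝟙 a * 𝟙 b ≡ 𝟙 (a ∧ b)
𝟙-* true b = *-identityˡ (𝟙 b)
𝟙-* false b = refl

if-then-0 : ∀ b x → (if b then x else + 0) ≡ 𝟙 b * x
if-then-0 true x = sym (*-identityˡ x)
if-then-0 false x = sym (*-zeroˡ x)

∧-absorbʳ : ∀ {a b} → (T a → T b) → a ∧ b ≡ a
∧-absorbʳ {true} a⇒b = Equivalence.to T-≡ (a⇒b tt)
∧-absorbʳ {false} _ = refl

∧-absorbˡ : ∀ {a b} → (T a → T b) → b ∧ a ≡ a
∧-absorbˡ {a} {b} a⇒b = trans (∧-comm b a) (∧-absorbʳ a⇒b)

T-⇒ : ∀ {a b} → T (not a ∨ b) → T a → T b
T-⇒ {true} b-holds _ = b-holds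

T-⇒-intro : ∀ {a b} → (T a → T b) → T (not a ∨ b)
T-⇒-intro {false} _ = tt
T-⇒-intro {true} a⇒b = a⇒b tt

T-lookup⇒∈ : ∀ {m} {SP : Subset m} {k} → T (lookup SP k) → k ∈ SP
T-lookup⇒∈ {SP = SP} {k} = lookup⇒[]= k SP ∘ Equivalence.to T-≡

∈⇒T-lookup : ∀ {m} {SP : Subset m} {k} → k ∈ SP → T (lookup SP k)
∈⇒T-lookup = Equivalence.from T-≡ ∘ []=⇒lookup

allF-elim : ∀ n g → T (allF n g) → ∀ k → T (g k)
allF-elim (suc n) g all zero = proj₁ (Equivalence.to T-∧ all)
allF-elim (suc n) g all (suc k) = allF-elim n (g ∘ suc) (proj₂ (Equivalence.to T-∧ all)) k

allF-intro : ∀ n g → (∀ k → T (g k)) → T (allF n g)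
allF-intro zero g _ = tt
allF-intro (suc n) g all = Equivalence.from T-∧ (all zero , allF-intro n (g ∘ suc) (all ∘ suc))

Σ-cong : ∀ n {f g : Fin n → ℤ} → (∀ i → f i ≡ g i) → Σℤ n f ≡ Σℤ n g
Σ-cong zero _ = refl
Σ-cong (suc n) f≗g = cong₂ _+_ (f≗g zero) (Σ-cong n (λ i → f≗g (suc i)))

Σℤ≡sum : ∀ n (f : Fin n → ℤ) → Σℤ n f ≡ sum f
Σℤ≡sum zero f = refl
Σℤ≡sum (suc n) f = cong (_+_ (f zero)) (Σℤ≡sum n (λ i → f (suc i)))

Σ-distrib-+ : ∀ n (f g : Fin n → ℤ) → Σℤ n (λ i → f i + g i) ≡ Σℤ n f + Σℤ n g
Σ-distrib-+ n f g =
  trans (Σℤ≡sum n _) (trans (∑-distrib-+ f g) (sym (cong₂ _+_ (Σℤ≡sum n f) (Σℤ≡sum n g))))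

*-distribˡ-Σ : ∀ n c (f : Fin n → ℤ) → c * Σℤ n f ≡ Σℤ n (λ i → c * f i)
*-distribˡ-Σ n c f =
  trans (cong (_*_ c) (Σℤ≡sum n f)) (trans (*-distribˡ-sum c f) (sym (Σℤ≡sum n _)))

Σ-comm : ∀ a b (f : Fin a → Fin b → ℤ) →
         Σℤ a (λ i → Σℤ b (f i)) ≡ Σℤ b (λ j → Σℤ a (λ i → f i j))
Σ-comm a b f = trans (Σℤ≡sum² a b f) (trans (∑-comm f) (sym (Σℤ≡sum² b a (λ j i → f i j))))
  where
  Σℤ≡sum² : ∀ a b (f : Fin a → Fin b → ℤ) → Σℤ a (λ i → Σℤ b (f i)) ≡ sum (λ i → sum (f i))
  Σℤ≡sum² a b f = trans (Σℤ≡sum a _) (sum-cong-≗ (λ i → Σℤ≡sum b (f i)))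

Σ-permute : ∀ n (f : Fin n → ℤ) (π : Weyl n) → Σℤ n f ≡ Σℤ n (λ i → f (π ⟨$⟩ˡ i))
Σ-permute n f π = trans (Σℤ≡sum n f) (trans (sum-permute f (flip π)) (sym (Σℤ≡sum n _)))

Σ-distrib-neg : ∀ n (f : Fin n → ℤ) → Σℤ n (λ i → - f i) ≡ - Σℤ n f
Σ-distrib-neg zero f = refl
Σ-distrib-neg (suc n) f =
  trans (cong (_+_ (- f zero)) (Σ-distrib-neg n _)) (sym (neg-distrib-+ (f zero) _))

Σ-distrib-- : ∀ n (f g : Fin n → ℤ) → Σℤ n (λ i → f i - g i) ≡ Σℤ n f - Σℤ n g
Σ-distrib-- n f g =
  trans (Σ-distrib-+ n f (λ i → - g i)) (cong (_+_ (Σℤ n f)) (Σ-distrib-neg n g))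

Σ-0 : ∀ n → Σℤ n (λ _ → + 0) ≡ + 0
Σ-0 zero = refl
Σ-0 (suc n) = trans (+-identityˡ _) (Σ-0 n)

Σ-replicate : ∀ n a → Σℤ n (λ _ → a) ≡ + n * a
Σ-replicate zero a = sym (*-zeroˡ a)
Σ-replicate (suc n) a = trans (cong (_+_ a) (Σ-replicate n a)) (sym (suc-* (+ n) a))

Σ-mono-≤ : ∀ n {f g : Fin n → ℤ} → (∀ i → f i ≤ g i) → Σℤ n f ≤ Σℤ n g
Σ-mono-≤ zero _ = ≤-refl
Σ-mono-≤ (suc n) f≤g = +-mono-≤ (f≤g zero) (Σ-mono-≤ n (λ i → f≤g (suc i)))

Σ-mono-< : ∀ n {f g : Fin n → ℤ} → (∀ i → f i ≤ g i) → ∀ i → f i < g i → Σℤ n f < Σℤ n g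
Σ-mono-< (suc n) f≤g zero fi<gi = +-mono-<-≤ fi<gi (Σ-mono-≤ n (λ i → f≤g (suc i)))
Σ-mono-< (suc n) f≤g (suc i) fi<gi =
  +-mono-≤-< (f≤g zero) (Σ-mono-< n (λ i → f≤g (suc i)) i fi<gi)

Σ-nonneg : ∀ n {f : Fin n → ℤ} → (∀ i → + 0 ≤ f i) → + 0 ≤ Σℤ n f
Σ-nonneg n {f} f≥0 = subst (_≤ Σℤ n f) (Σ-0 n) (Σ-mono-≤ n f≥0)

Σ-nonneg-≡0 : ∀ n {f : Fin n → ℤ} → (∀ i → + 0 ≤ f i) → Σℤ n f ≡ + 0 → ∀ i → f i ≡ + 0
Σ-nonneg-≡0 n {f} f≥0 Σ≡0 i = ≤-antisym (≮⇒≥ fi≯0) (f≥0 i)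
  where
  fi≯0 : ¬ (+ 0 < f i)
  fi≯0 0<fi = <-irrefl (trans (Σ-0 n) (sym Σ≡0)) (Σ-mono-< n f≥0 i 0<fi)

countℕ : ∀ n → (Fin n → Bool) → ℕ
countℕ n p = Σℕ n (λ y → if p y then 1 else 0)

countℕ-pos : ∀ n (p : Fin n → Bool) i → T (p i) → suc (pred (countℕ n p)) ≡ countℕ n p
countℕ-pos (suc n) p zero pi with p zero
... | true = refl
countℕ-pos (suc n) p (suc i) pi with p zero
... | true = refl
... | false = countℕ-pos n (p ∘′ suc) i pi

Σ-if-≥ : ∀ n (p : Fin n → Bool) (g : Fin n → ℤ) a → (∀ y → T (p y) → a ≤ g y) →
         a * + countℕ n p ≤ Σℤ n (λ y → if p y then g y else + 0)
Σ-if-≥ zero p g a _ = ≤-reflexive (*-zeroʳ a)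
Σ-if-≥ (suc n) p g a a≤g with p zero | a≤g zero
... | true | a≤g₀ =
  ≤-trans (≤-reflexive (*-suc a (+ countℕ n (p ∘′ suc))))
          (+-mono-≤ (a≤g₀ tt) (Σ-if-≥ n (p ∘′ suc) (g ∘′ suc) a (λ y → a≤g (suc y))))
... | false | _ =
  ≤-trans (Σ-if-≥ n (p ∘′ suc) (g ∘′ suc) a (λ y → a≤g (suc y))) (≤-reflexive (sym (+-identityˡ _)))

Σ-if-≤ : ∀ n (p : Fin n → Bool) (g : Fin n → ℤ) b → (∀ y → T (p y) → g y ≤ b) →
         Σℤ n (λ y → if p y then g y else + 0) ≤ b * + countℕ n p
Σ-if-≤ zero p g b _ = ≤-reflexive (sym (*-zeroʳ b))
Σ-if-≤ (suc n) p g b g≤b with p zero | g≤b zero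
... | true | g₀≤b =
  ≤-trans (+-mono-≤ (g₀≤b tt) (Σ-if-≤ n (p ∘′ suc) (g ∘′ suc) b (λ y → g≤b (suc y))))
          (≤-reflexive (sym (*-suc b (+ countℕ n (p ∘′ suc)))))
... | false | _ =
  ≤-trans (≤-reflexive (+-identityˡ _)) (Σ-if-≤ n (p ∘′ suc) (g ∘′ suc) b (λ y → g≤b (suc y)))

count : ∀ {n} → (Fin n → Bool) → ℤ
count {n} p = Σℤ n (λ x → 𝟙 (p x))

count-∧-gap-nonneg : ∀ {n} (p q : Fin n → Bool) → + 0 ≤ count p - count (λ x → p x ∧ q x)
count-∧-gap-nonneg {n} p q =
  i≤j⇒0≤j-i (Σ-mono-≤ n (λ x → 𝟙-mono (proj₁ ∘ Equivalence.to T-∧)))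

count-∧-gap≡0 : ∀ {n} (p q : Fin n → Bool) → count p - count (λ x → p x ∧ q x) ≡ + 0 →
                ∀ x → T (p x) → T (q x)
count-∧-gap≡0 {n} p q gap≡0 x px with T? (q x)
... | yes qx = qx
... | no ¬qx = ⊥-elim (<-irrefl (sym (i-j≡0⇒i≡j _ _ gap≡0))
  (Σ-mono-< n (λ _ → 𝟙-mono (proj₁ ∘ Equivalence.to T-∧)) x
    (𝟙-< (¬qx ∘ proj₂ ∘ Equivalence.to T-∧) px)))

module _ {m ℓ} {R : Rel (Fin (suc m)) ℓ} (R-refl : Reflexive R) (R-trans : Transitive R) where

  stepwise : ∀ {i j} → i Fin.≤ j →
             (∀ (k : Fin m) → i Fin.≤ k → k Fin.< j → R (inject₁ k) (suc k)) → R i j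
  stepwise {i} {j} = <-weakInduction P base step j
    where
    P : Pred (Fin (suc m)) ℓ
    P j = i Fin.≤ j → (∀ (k : Fin m) → i Fin.≤ k → k Fin.< j → R (inject₁ k) (suc k)) → R i j
    base : P zero
    base i≤0 _ = subst (λ x → R x zero) (sym (toℕ-injective (ℕ.n≤0⇒n≡0 i≤0))) R-refl
    step : ∀ j → P (inject₁ j) → P (suc j)
    step j ih i≤j+1 steps with toℕ i ℕ.≤? toℕ j
    ... | yes i≤j =
      R-trans (ih (subst (toℕ i ℕ.≤_) (sym (toℕ-inject₁ j)) i≤j) steps′) (steps j i≤j ℕ.≤-refl)
      where
      steps′ : ∀ k → i Fin.≤ k → k Fin.< inject₁ j → R (inject₁ k) (suc k)
      steps′ k i≤k k<j = steps k i≤k (ℕ.m<n⇒m<1+n (subst (toℕ k ℕ.<_) (toℕ-inject₁ j) k<j))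
    ... | no i≰j =
      subst (λ x → R x (suc j)) (sym (toℕ-injective (ℕ.≤-antisym i≤j+1 (ℕ.≰⇒> i≰j)))) R-refl

adjacent-increasing⇒id : ∀ {m} (s : Fin (suc m) → Fin (suc m)) →
                         (∀ k → s (inject₁ k) Fin.< s (suc k)) → ∀ i → s i ≡ i
adjacent-increasing⇒id {m} s increasing i = toℕ-injective (ℕ.≤-antisym (s≤id i) (id≤s i))
  where
  id≤s : ∀ i → toℕ i ℕ.≤ toℕ (s i)
  id≤s = <-weakInduction (λ i → toℕ i ℕ.≤ toℕ (s i)) ℕ.z≤n λ i ih →
    ℕ.≤-trans (ℕ.s≤s (subst (ℕ._≤ toℕ (s (inject₁ i))) (toℕ-inject₁ i) ih)) (increasing i)
  s≤id : ∀ i → toℕ (s i) ℕ.≤ toℕ i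
  s≤id = >-weakInduction (λ i → toℕ (s i) ℕ.≤ toℕ i)
    (subst (toℕ (s (fromℕ m)) ℕ.≤_) (sym (toℕ-fromℕ m)) (toℕ≤pred[n] (s (fromℕ m)))) λ i ih →
    subst (toℕ (s (inject₁ i)) ℕ.≤_) (sym (toℕ-inject₁ i)) (ℕ.≤-pred (ℕ.<-≤-trans (increasing i) ih))

e-sym : ∀ {n} (i j : Fin n) → e i j ≡ e j i
e-sym i j with i Fin.≟ j | j Fin.≟ i
... | yes _ | yes _ = refl
... | no _ | no _ = refl
... | yes i≡j | no j≢i = ⊥-elim (j≢i (sym i≡j))
... | no i≢j | yes j≡i = ⊥-elim (i≢j (sym j≡i))

Σ-select : ∀ {n} (g : Fin n → ℤ) x → Σℤ n (λ j → g j * e j x) ≡ g x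
Σ-select {suc n} g zero =
  trans (cong₂ _+_ (*-identityʳ (g zero)) (trans (Σ-cong n (λ j → *-zeroʳ (g (suc j)))) (Σ-0 n)))
        (+-identityʳ (g zero))
Σ-select {suc n} g (suc x) =
  trans (cong₂ _+_ (*-zeroʳ (g zero)) (Σ-select (λ j → g (suc j)) x)) (+-identityˡ _)

Σ-select′ : ∀ {n} (g : Fin n → ℤ) i → Σℤ n (λ x → g x * e i x) ≡ g i
Σ-select′ {n} g i = trans (Σ-cong n (λ x → cong (g x *_) (e-sym i x))) (Σ-select g i)

prefix : ∀ {m} → Fin m → Fin (suc m) → Bool
prefix K x = toℕ x ≤ᵇ toℕ K

prefix-mono : ∀ {m} {K l : Fin m} → toℕ K ℕ.≤ toℕ l → ∀ x → T (prefix K x) → T (prefix l x)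
prefix-mono K≤l x x≤K = ℕ.≤⇒≤ᵇ (ℕ.≤-trans (ℕ.≤ᵇ⇒≤ (toℕ x) _ x≤K) K≤l)

suc≤ᵇsuc : ∀ a b → (suc a ≤ᵇ suc b) ≡ (a ≤ᵇ b)
suc≤ᵇsuc zero b = refl
suc≤ᵇsuc (suc a) b = refl

count-prefix : ∀ {m} (l : Fin m) → count (prefix l) ≡ + suc (toℕ l)
count-prefix {suc m} zero = cong (_+_ (+ 1)) (Σ-0 (suc m))
count-prefix {suc m} (suc l) = cong (_+_ (+ 1))
  (trans (Σ-cong (suc m) (λ x → cong 𝟙 (suc≤ᵇsuc (toℕ x) (toℕ l)))) (count-prefix l))

θG-coord : ∀ {m} (x : Fin (suc m)) → θG {m} x ≡ Σℤ m (λ l → 𝟙 (prefix l x))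
θG-coord {m} x = Σ-cong m λ l →
  trans (Σ-cong (suc m) (λ j → if-then-0 (prefix l j) (e j x))) (Σ-select (𝟙 ∘ prefix l) x)

eSet-coord : ∀ {n} (S : Subset n) x → eSet S x ≡ 𝟙 (lookup S x)
eSet-coord {n} S x =
  trans (Σ-cong n (λ j → if-then-0 (lookup S j) (e j x))) (Σ-select (𝟙 ∘ lookup S) x)

∣∣≡count : ∀ {n} (S : Subset n) → + ∣ S ∣ ≡ count (lookup S)
∣∣≡count [] = refl
∣∣≡count (true ∷ S) = cong (_+_ (+ 1)) (∣∣≡count S)
∣∣≡count (false ∷ S) = trans (∣∣≡count S) (sym (+-identityˡ _))

-- Pairing with the fundamental coweight e₀ + ⋯ + e_K, which reads off the coefficient of α_K.
prefixSum : ∀ {m} → Fin m → (Fin (suc m) → ℤ) → ℤ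
prefixSum {m} K g = Σℤ (suc m) (λ x → 𝟙 (prefix K x) * g x)

prefixSum-Σ : ∀ {m} (K : Fin m) a (g : Fin a → Fin (suc m) → ℤ) →
              prefixSum K (λ x → Σℤ a (λ i → g i x)) ≡ Σℤ a (λ i → prefixSum K (g i))
prefixSum-Σ {m} K a g =
  trans (Σ-cong (suc m) (λ x → *-distribˡ-Σ a (𝟙 (prefix K x)) (λ i → g i x)))
        (Σ-comm (suc m) a (λ x i → 𝟙 (prefix K x) * g i x))

prefixSum-scale : ∀ {m} (K : Fin m) c (g : Fin (suc m) → ℤ) →
                  prefixSum K (λ x → c * g x) ≡ c * prefixSum K g
prefixSum-scale {m} K c g =
  trans (Σ-cong (suc m) (λ x → x∙yz≈y∙xz (𝟙 (prefix K x)) c (g x)))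
        (sym (*-distribˡ-Σ (suc m) c (λ x → 𝟙 (prefix K x) * g x)))

prefix-step : ∀ {m} (k K : Fin m) → 𝟙 (prefix K (inject₁ k)) - 𝟙 (prefix K (suc k)) ≡ e k K
prefix-step zero zero = refl
prefix-step zero (suc K) = refl
prefix-step (suc k) zero = refl
prefix-step (suc k) (suc K) =
  trans (cong₂ (λ a b → 𝟙 a - 𝟙 b) (suc≤ᵇsuc (toℕ (inject₁ k)) (toℕ K))
                                   (suc≤ᵇsuc (suc (toℕ k)) (toℕ K)))
        (prefix-step k K)

prefixSum-α : ∀ {m} (k K : Fin m) → prefixSum K (α k) ≡ e k K
prefixSum-α {m} k K = begin
  prefixSum K (α k)
    ≡⟨ Σ-cong (suc m) (λ x → x[y-z]≈xy-xz (𝟙 (prefix K x)) (e (inject₁ k) x) (e (suc k) x)) ⟩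
  Σℤ (suc m) (λ x → 𝟙 (prefix K x) * e (inject₁ k) x - 𝟙 (prefix K x) * e (suc k) x)
    ≡⟨ Σ-distrib-- (suc m) (λ x → 𝟙 (prefix K x) * e (inject₁ k) x)
                           (λ x → 𝟙 (prefix K x) * e (suc k) x) ⟩
  prefixSum K (e (inject₁ k)) - prefixSum K (e (suc k))
    ≡⟨ cong₂ _-_ (Σ-select′ (𝟙 ∘ prefix K) (inject₁ k)) (Σ-select′ (𝟙 ∘ prefix K) (suc k)) ⟩
  𝟙 (prefix K (inject₁ k)) - 𝟙 (prefix K (suc k))
    ≡⟨ prefix-step k K ⟩
  e k K ∎
  where open ≡-Reasoning

prefixSum-roots : ∀ {m} (c : Fin m → ℤ) K →
                  prefixSum K (λ x → Σℤ m (λ k → c k * α k x)) ≡ c K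
prefixSum-roots {m} c K = begin
  prefixSum K (λ x → Σℤ m (λ k → c k * α k x))
    ≡⟨ prefixSum-Σ K m (λ k x → c k * α k x) ⟩
  Σℤ m (λ k → prefixSum K (λ x → c k * α k x))
    ≡⟨ Σ-cong m (λ k → trans (prefixSum-scale K (c k) (α k)) (cong (c k *_) (prefixSum-α k K))) ⟩
  Σℤ m (λ k → c k * e k K)
    ≡⟨ Σ-select c K ⟩
  c K ∎
  where open ≡-Reasoning

-- |{0,…,K} ∩ {0,…,l}| − |{0,…,K} ∩ t|.  When |t| = l + 1 it is nonnegative, and it vanishes
-- only if {0,…,K} ⊆ t (case K ≤ l) or t ⊆ {0,…,K} (case l ≤ K).
defect : ∀ {m} → (Fin (suc m) → Bool) → Fin m → Fin m → ℤ
defect t l K = prefixSum K (λ x → 𝟙 (prefix l x) - 𝟙 (t x))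

module _ {m} (t : Fin (suc m) → Bool) (l K : Fin m) where

  private
    P = prefix K

    count-∧-comm : ∀ (p q : Fin (suc m) → Bool) →
                   count (λ x → p x ∧ q x) ≡ count (λ x → q x ∧ p x)
    count-∧-comm p q = Σ-cong (suc m) (λ x → cong 𝟙 (∧-comm (p x) (q x)))

    defect≡ : defect t l K ≡ count (λ x → P x ∧ prefix l x) - count (λ x → P x ∧ t x)
    defect≡ =
      trans (Σ-cong (suc m) (λ x → trans (x[y-z]≈xy-xz (𝟙 (P x)) (𝟙 (prefix l x)) (𝟙 (t x)))
                                         (cong₂ _-_ (𝟙-* (P x) (prefix l x)) (𝟙-* (P x) (t x)))))
            (Σ-distrib-- (suc m) (λ x → 𝟙 (P x ∧ prefix l x)) (λ x → 𝟙 (P x ∧ t x)))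

    defect-K≤l : toℕ K ℕ.≤ toℕ l → defect t l K ≡ count P - count (λ x → P x ∧ t x)
    defect-K≤l K≤l = trans defect≡ (cong (_- count (λ x → P x ∧ t x))
      (Σ-cong (suc m) (λ x → cong 𝟙 (∧-absorbʳ (prefix-mono K≤l x)))))

    defect-l≤K : count t ≡ + suc (toℕ l) → toℕ l ℕ.≤ toℕ K →
                 defect t l K ≡ count t - count (λ x → t x ∧ P x)
    defect-l≤K #t l≤K = trans defect≡ (cong₂ _-_ #P∧L (count-∧-comm P t))
      where
      #P∧L : count (λ x → P x ∧ prefix l x) ≡ count t
      #P∧L = begin
        count (λ x → P x ∧ prefix l x)
          ≡⟨ count-∧-comm P (prefix l) ⟩
        count (λ x → prefix l x ∧ P x)
          ≡⟨ Σ-cong (suc m) (λ x → cong 𝟙 (∧-absorbʳ (prefix-mono l≤K x))) ⟩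
        count (prefix l)
          ≡⟨ count-prefix l ⟩
        + suc (toℕ l)
          ≡⟨ #t ⟨
        count t ∎
        where open ≡-Reasoning

  defect-nonneg : count t ≡ + suc (toℕ l) → + 0 ≤ defect t l K
  defect-nonneg #t with ℕ.≤-total (toℕ K) (toℕ l)
  ... | inj₁ K≤l = subst (+ 0 ≤_) (sym (defect-K≤l K≤l)) (count-∧-gap-nonneg P t)
  ... | inj₂ l≤K = subst (+ 0 ≤_) (sym (defect-l≤K #t l≤K)) (count-∧-gap-nonneg t P)

  defect≡0⇒prefix⊆ : toℕ K ℕ.≤ toℕ l → defect t l K ≡ + 0 → ∀ x → T (P x) → T (t x)
  defect≡0⇒prefix⊆ K≤l d≡0 = count-∧-gap≡0 P t (trans (sym (defect-K≤l K≤l)) d≡0)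

  defect≡0⇒⊆prefix : count t ≡ + suc (toℕ l) → toℕ l ℕ.≤ toℕ K → defect t l K ≡ + 0 →
                     ∀ x → T (t x) → T (P x)
  defect≡0⇒⊆prefix #t l≤K d≡0 = count-∧-gap≡0 t P (trans (sym (defect-l≤K #t l≤K)) d≡0)

module WeightSeparation {m f : ℕ} (μ : Weight (suc m))
  (S : Fin f → Fin m → Subset (suc m)) (∣S∣ : ∀ j l → ∣ S j l ∣ ≡ suc (toℕ l))
  (μ≡ : ∀ x → μ x ≡ Σℤ f (λ j → Σℤ m (λ l → eSet (S j l) x)))
  (w′ : Weyl (suc m)) (c : Fin m → ℤ) (expansion : RootExpansion f w′ μ c) where

  w′S : Fin f → Fin m → Fin (suc m) → Bool
  w′S j l x = lookup (S j l) (w′ ⟨$⟩ˡ x)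

  w′S-w′ : ∀ j l y → w′S j l (w′ ⟨$⟩ʳ y) ≡ lookup (S j l) y
  w′S-w′ j l y = cong (lookup (S j l)) (inverseˡ w′)

  count-w′S : ∀ j l → count (w′S j l) ≡ + suc (toℕ l)
  count-w′S j l = begin
    count (w′S j l)           ≡⟨ Σ-permute (suc m) (𝟙 ∘ lookup (S j l)) w′ ⟨
    count (lookup (S j l))    ≡⟨ ∣∣≡count (S j l) ⟨
    + ∣ S j l ∣               ≡⟨ cong +_ (∣S∣ j l) ⟩
    + suc (toℕ l)             ∎
    where open ≡-Reasoning

  μ-coord : ∀ y → μ y ≡ Σℤ f (λ j → Σℤ m (λ l → 𝟙 (lookup (S j l) y)))
  μ-coord y = trans (μ≡ y) (Σ-cong f (λ j → Σ-cong m (λ l → eSet-coord (S j l) y)))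

  expansion-coord : ∀ x → + f * θG x - act w′ μ x ≡
                          Σℤ f (λ j → Σℤ m (λ l → 𝟙 (prefix l x) - 𝟙 (w′S j l x)))
  expansion-coord x = begin
    + f * θG x - act w′ μ x
      ≡⟨ cong₂ _-_ (trans (sym (Σ-replicate f (θG x))) (Σ-cong f (λ _ → θG-coord x)))
                   (μ-coord (w′ ⟨$⟩ˡ x)) ⟩
    Σℤ f (λ _ → Σℤ m (λ l → 𝟙 (prefix l x))) - Σℤ f (λ j → Σℤ m (λ l → 𝟙 (w′S j l x)))
      ≡⟨ Σ-distrib-- f (λ _ → Σℤ m (λ l → 𝟙 (prefix l x))) (λ j → Σℤ m (λ l → 𝟙 (w′S j l x))) ⟨
    Σℤ f (λ j → Σℤ m (λ l → 𝟙 (prefix l x)) - Σℤ m (λ l → 𝟙 (w′S j l x)))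
      ≡⟨ Σ-cong f (λ j → Σ-distrib-- m (λ l → 𝟙 (prefix l x)) (λ l → 𝟙 (w′S j l x))) ⟨
    Σℤ f (λ j → Σℤ m (λ l → 𝟙 (prefix l x) - 𝟙 (w′S j l x))) ∎
    where open ≡-Reasoning

  c≡Σdefect : ∀ K → c K ≡ Σℤ f (λ j → Σℤ m (λ l → defect (w′S j l) l K))
  c≡Σdefect K = begin
    c K
      ≡⟨ prefixSum-roots c K ⟨
    prefixSum K (λ x → Σℤ m (λ k → c k * α k x))
      ≡⟨ Σ-cong (suc m) (λ x → cong (𝟙 (prefix K x) *_)
                                    (trans (sym (expansion x)) (expansion-coord x))) ⟩
    prefixSum K (λ x → Σℤ f (λ j → Σℤ m (λ l → 𝟙 (prefix l x) - 𝟙 (w′S j l x))))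
      ≡⟨ prefixSum-Σ K f (λ j x → Σℤ m (λ l → 𝟙 (prefix l x) - 𝟙 (w′S j l x))) ⟩
    Σℤ f (λ j → prefixSum K (λ x → Σℤ m (λ l → 𝟙 (prefix l x) - 𝟙 (w′S j l x))))
      ≡⟨ Σ-cong f (λ j → prefixSum-Σ K m (λ l x → 𝟙 (prefix l x) - 𝟙 (w′S j l x))) ⟩
    Σℤ f (λ j → Σℤ m (λ l → defect (w′S j l) l K)) ∎
    where open ≡-Reasoning

  defect≡0 : ∀ {K} → c K ≡ + 0 → ∀ j l → defect (w′S j l) l K ≡ + 0
  defect≡0 {K} cK≡0 j l =
    Σ-nonneg-≡0 m (d≥0 j)
      (Σ-nonneg-≡0 f (λ j → Σ-nonneg m (d≥0 j)) (trans (sym (c≡Σdefect K)) cK≡0) j) l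
    where
    d≥0 : ∀ j l → + 0 ≤ defect (w′S j l) l K
    d≥0 j l = defect-nonneg (w′S j l) l K (count-w′S j l)

  lowerBound upperBound : Fin m → ℤ
  lowerBound K = Σℤ f (λ _ → Σℤ m (λ l → 𝟙 (toℕ K ≤ᵇ toℕ l)))
  upperBound K = Σℤ f (λ _ → Σℤ m (λ l → 𝟙 (toℕ K <ᵇ toℕ l)))

  upperBound<lowerBound : Fin f → ∀ K → upperBound K < lowerBound K
  upperBound<lowerBound j₀ K =
    Σ-mono-< f (λ _ → Σ-mono-≤ m <ᵇ≤≤ᵇ) j₀ (Σ-mono-< m <ᵇ≤≤ᵇ K K<ᵇK<K≤ᵇK)
    where
    <ᵇ≤≤ᵇ : ∀ l → 𝟙 (toℕ K <ᵇ toℕ l) ≤ 𝟙 (toℕ K ≤ᵇ toℕ l)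
    <ᵇ≤≤ᵇ l = 𝟙-mono (ℕ.≤⇒≤ᵇ ∘ ℕ.<⇒≤ ∘ ℕ.<ᵇ⇒< (toℕ K) (toℕ l))
    K<ᵇK<K≤ᵇK : 𝟙 (toℕ K <ᵇ toℕ K) < 𝟙 (toℕ K ≤ᵇ toℕ K)
    K<ᵇK<K≤ᵇK = 𝟙-< (ℕ.<-irrefl refl ∘ ℕ.<ᵇ⇒< (toℕ K) (toℕ K)) (ℕ.≤⇒≤ᵇ (ℕ.≤-refl {toℕ K}))

  lowerBound≤μ : ∀ {K} → c K ≡ + 0 → ∀ y → toℕ (w′ ⟨$⟩ʳ y) ℕ.≤ toℕ K → lowerBound K ≤ μ y
  lowerBound≤μ {K} cK≡0 y w′y≤K = subst (lowerBound K ≤_) (sym (μ-coord y))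
    (Σ-mono-≤ f (λ j → Σ-mono-≤ m (λ l → 𝟙-mono (y∈S j l))))
    where
    y∈S : ∀ j l → T (toℕ K ≤ᵇ toℕ l) → T (lookup (S j l) y)
    y∈S j l K≤l = subst T (w′S-w′ j l y)
      (defect≡0⇒prefix⊆ (w′S j l) l K (ℕ.≤ᵇ⇒≤ (toℕ K) (toℕ l) K≤l) (defect≡0 cK≡0 j l)
        (w′ ⟨$⟩ʳ y) (ℕ.≤⇒≤ᵇ w′y≤K))

  μ≤upperBound : ∀ {K} → c K ≡ + 0 → ∀ y → toℕ K ℕ.< toℕ (w′ ⟨$⟩ʳ y) → μ y ≤ upperBound K
  μ≤upperBound {K} cK≡0 y K<w′y = subst (_≤ upperBound K) (sym (μ-coord y))
    (Σ-mono-≤ f (λ j → Σ-mono-≤ m (λ l → 𝟙-mono (ℕ.<⇒<ᵇ ∘ K<l j l))))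
    where
    K<l : ∀ j l → T (lookup (S j l) y) → toℕ K ℕ.< toℕ l
    K<l j l y∈S with toℕ K ℕ.<? toℕ l
    ... | yes K<l = K<l
    ... | no K≮l = ⊥-elim (ℕ.<⇒≱ K<w′y (ℕ.≤ᵇ⇒≤ (toℕ (w′ ⟨$⟩ʳ y)) (toℕ K)
      (defect≡0⇒⊆prefix (w′S j l) l K (count-w′S j l) (ℕ.≮⇒≥ K≮l) (defect≡0 cK≡0 j l)
        (w′ ⟨$⟩ʳ y) (subst T (sym (w′S-w′ j l y)) y∈S))))

-- rootAt SP i says α_i ∈ S(P); it is false at the last index, which starts no simple root.
rootAt : ∀ {m} → Subset m → Fin (suc m) → Bool
rootAt [] _ = false
rootAt (b ∷ bs) zero = b
rootAt (b ∷ bs) (suc i) = rootAt bs i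

rootAt-inject₁ : ∀ {m} (SP : Subset m) k → rootAt SP (inject₁ k) ≡ lookup SP k
rootAt-inject₁ (b ∷ bs) zero = refl
rootAt-inject₁ (b ∷ bs) (suc k) = rootAt-inject₁ bs k

rootAt-sound : ∀ {m} (SP : Subset m) i → T (rootAt SP i) →
               Σ (Fin m) λ k → inject₁ k ≡ i × T (lookup SP k)
rootAt-sound (b ∷ bs) zero b-holds = zero , refl , b-holds
rootAt-sound (b ∷ bs) (suc i) r with rootAt-sound bs i r
... | k , refl , k∈bs = suc k , refl , k∈bs

module RootImage {m} (SP : StdParabolic m) where

  rootImage : Weyl (suc m) → Fin (suc m) → Bool
  rootImage σ p = rootAt SP (σ ⟨$⟩ˡ p)

  image-of-root : ∀ {σ k K} → MapsIntoSimple σ SP → k ∈ SP → σ ⟨$⟩ʳ inject₁ k ≡ inject₁ K →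
                  InImage σ SP K
  image-of-root {σ} {k} {K} maps k∈SP σk≡K = k , k∈SP , σk≡K ,
    toℕ-injective (trans (maps k k∈SP) (cong suc (trans (cong toℕ σk≡K) (toℕ-inject₁ K))))

  InImage⇒rootImage : ∀ {σ K} → InImage σ SP K → T (rootImage σ (inject₁ K))
  InImage⇒rootImage {σ} (k , k∈SP , σk≡K , _) =
    subst T (sym (trans (cong (rootAt SP) σ⁻¹K≡k) (rootAt-inject₁ SP k))) (∈⇒T-lookup k∈SP)
    where
    σ⁻¹K≡k : σ ⟨$⟩ˡ _ ≡ inject₁ k
    σ⁻¹K≡k = trans (cong (σ ⟨$⟩ˡ_) (sym σk≡K)) (inverseˡ σ)

  rootImage⇒InImage : ∀ {σ K} → MapsIntoSimple σ SP → T (rootImage σ (inject₁ K)) → InImage σ SP K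
  rootImage⇒InImage {σ} {K} maps r with rootAt-sound SP _ r
  ... | k , k≡σ⁻¹K , k∈SP =
    image-of-root {σ} maps (T-lookup⇒∈ {SP = SP} k∈SP) (trans (cong (σ ⟨$⟩ʳ_) k≡σ⁻¹K) (inverseʳ σ))

  InImage? : ∀ {σ} → MapsIntoSimple σ SP → ∀ K → Dec (InImage σ SP K)
  InImage? {σ} maps K =
    map′ (rootImage⇒InImage {σ} maps) (InImage⇒rootImage {σ}) (T? (rootImage σ (inject₁ K)))

  ¬rootImage-last : ∀ {σ} → MapsIntoSimple σ SP → ¬ T (rootImage σ (fromℕ m))
  ¬rootImage-last {σ} maps r with rootAt-sound SP _ r
  ... | k , k≡σ⁻¹m , k∈SP =
    ℕ.<-irrefl refl (ℕ.≤-trans (ℕ.s≤s (ℕ.≤-reflexive (sym σ[k+1]≡m+1))) (toℕ<n (σ ⟨$⟩ʳ suc k)))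
    where
    σ[k+1]≡m+1 : toℕ (σ ⟨$⟩ʳ suc k) ≡ suc m
    σ[k+1]≡m+1 = trans (maps k (T-lookup⇒∈ {SP = SP} k∈SP)) (cong suc
      (trans (cong (toℕ ∘ (σ ⟨$⟩ʳ_)) k≡σ⁻¹m) (trans (cong toℕ (inverseʳ σ)) (toℕ-fromℕ m))))

  count-rootImage : ∀ σ → count (rootImage σ) ≡ count (rootAt SP)
  count-rootImage σ = sym (Σ-permute (suc m) (𝟙 ∘ rootAt SP) σ)

  module SameImage (w w′ : Weyl (suc m))
    (maps : MapsIntoSimple w SP) (maps′ : MapsIntoSimple w′ SP)
    (c : Fin m → ℤ) (P≡wP : ∀ k → InPC SP w′ c k ⇔ InImage w SP k) where

    rootImage-⊆ : ∀ p → T (rootImage w′ p) → T (rootImage w p)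
    rootImage-⊆ p with view p
    ... | ‵fromℕ = ⊥-elim ∘ ¬rootImage-last {w′} maps′
    ... | ‵inject₁ k =
      InImage⇒rootImage {w} ∘ Equivalence.to (P≡wP k) ∘ inj₁ ∘ rootImage⇒InImage {w′} maps′

    -- An inclusion between two sets of the same size |S(P)|.
    rootImage-⊇ : ∀ p → T (rootImage w p) → T (rootImage w′ p)
    rootImage-⊇ = count-∧-gap≡0 (rootImage w) (rootImage w′) (begin
      count (rootImage w) - count (λ p → rootImage w p ∧ rootImage w′ p)
        ≡⟨ cong (_-_ (count (rootImage w)))
                (Σ-cong (suc m) (λ p → cong 𝟙 (∧-absorbˡ (rootImage-⊆ p)))) ⟩
      count (rootImage w) - count (rootImage w′)
        ≡⟨ cong₂ _-_ (count-rootImage w) (count-rootImage w′) ⟩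
      count (rootAt SP) - count (rootAt SP)
        ≡⟨ +-inverseʳ (count (rootAt SP)) ⟩
      + 0 ∎)
      where open ≡-Reasoning

    c≡0 : ∀ K → ¬ InImage w′ SP K → c K ≡ + 0
    c≡0 K K∉w′S with c K ℤ.≟ + 0
    ... | yes cK≡0 = cK≡0
    ... | no cK≢0 = ⊥-elim (K∉w′S (rootImage⇒InImage {w′} maps′ (rootImage-⊇ (inject₁ K)
      (InImage⇒rootImage {w} (Equivalence.to (P≡wP K) (inj₂ cK≢0))))))

module _ {m} (SP : StdParabolic m) where

  sameBlock-sym : ∀ i j → sameBlock SP i j ≡ sameBlock SP j i
  sameBlock-sym i j =
    cong₂ (λ lo hi → allF m (λ k → not ((lo ≤ᵇ toℕ k) ∧ (toℕ k <ᵇ hi)) ∨ lookup SP k))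
          (ℕ.⊓-comm (toℕ i) (toℕ j)) (ℕ.⊔-comm (toℕ i) (toℕ j))

  sameBlock-refl : ∀ i → T (sameBlock SP i i)
  sameBlock-refl i = allF-intro m _ (λ k → T-⇒-intro (⊥-elim ∘ i≤k<i k))
    where
    i≤k<i : ∀ k → ¬ T (((toℕ i ⊓ toℕ i) ≤ᵇ toℕ k) ∧ (toℕ k <ᵇ (toℕ i ⊔ toℕ i)))
    i≤k<i k between with Equivalence.to T-∧ between
    ... | i≤k , k<i = ℕ.<-irrefl refl (ℕ.<-≤-trans
      (subst (toℕ k ℕ.<_) (ℕ.⊔-idem (toℕ i)) (ℕ.<ᵇ⇒< (toℕ k) _ k<i))
      (subst (ℕ._≤ toℕ k) (ℕ.⊓-idem (toℕ i)) (ℕ.≤ᵇ⇒≤ _ (toℕ k) i≤k)))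

  sameBlock⇒∈ : ∀ {i j} (k : Fin m) → T (sameBlock SP i j) → i Fin.≤ k → k Fin.< j → k ∈ SP
  sameBlock⇒∈ {i} {j} k same i≤k k<j =
    T-lookup⇒∈ {SP = SP} (T-⇒ (allF-elim m _ same k) (Equivalence.from T-∧
      (ℕ.≤⇒≤ᵇ (ℕ.≤-trans (ℕ.m⊓n≤m (toℕ i) (toℕ j)) i≤k) ,
       ℕ.<⇒<ᵇ (ℕ.<-≤-trans k<j (ℕ.m≤n⊔m (toℕ i) (toℕ j))))))

  sameBlock-right⇒root : ∀ {j y} → j Fin.< y → T (sameBlock SP j y) →
                         Σ (Fin m) λ k → inject₁ k ≡ j × k ∈ SP
  sameBlock-right⇒root {j} {y} j<y same = k , inject₁-lower₁ j m≢j ,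
    sameBlock⇒∈ k same (ℕ.≤-reflexive (sym (toℕ-lower₁ j m≢j)))
                       (subst (ℕ._< toℕ y) (sym (toℕ-lower₁ j m≢j)) j<y)
    where
    m≢j : m ≢ toℕ j
    m≢j m≡j = ℕ.<-irrefl (sym m≡j) (ℕ.<-≤-trans j<y (toℕ≤pred[n] y))
    k : Fin m
    k = lower₁ j m≢j

  sameBlock-left⇒root : ∀ {j y} → y Fin.< j → T (sameBlock SP j y) →
                        Σ (Fin m) λ t → suc t ≡ j × t ∈ SP
  sameBlock-left⇒root {suc t} {y} y<j same = t , refl ,
    sameBlock⇒∈ t (subst T (sameBlock-sym (suc t) y) same) (ℕ.≤-pred y<j) (ℕ.n<1+n (toℕ t))

  block-monotone : ∀ {σ} → MapsIntoSimple σ SP → ∀ {i j} → T (sameBlock SP i j) → i Fin.≤ j →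
                   σ ⟨$⟩ʳ i Fin.≤ σ ⟨$⟩ʳ j
  block-monotone {σ} maps {i} {j} same i≤j =
    stepwise {R = λ a b → σ ⟨$⟩ʳ a Fin.≤ σ ⟨$⟩ʳ b} ℕ.≤-refl ℕ.≤-trans i≤j λ k i≤k k<j →
      ℕ.≤-trans (ℕ.n≤1+n _) (ℕ.≤-reflexive (sym (maps k (sameBlock⇒∈ k same i≤k k<j))))

  open RootImage SP using (image-of-root)

  module BlockImages (σ : Weyl (suc m)) (maps : MapsIntoSimple σ SP)
    (K : Fin m) (K∉σS : ¬ InImage σ SP K) where

    block-below : ∀ {j y} → σ ⟨$⟩ʳ j ≡ inject₁ K → T (sameBlock SP j y) → σ ⟨$⟩ʳ y Fin.≤ K
    block-below {j} {y} σj≡K same with toℕ y ℕ.≤? toℕ j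
    ... | yes y≤j = subst (toℕ (σ ⟨$⟩ʳ y) ℕ.≤_) (trans (cong toℕ σj≡K) (toℕ-inject₁ K))
                      (block-monotone {σ} maps (subst T (sameBlock-sym j y) same) y≤j)
    ... | no y≰j with sameBlock-right⇒root (ℕ.≰⇒> y≰j) same
    ...   | k , k≡j , k∈SP =
      ⊥-elim (K∉σS (image-of-root {σ} maps k∈SP (trans (cong (σ ⟨$⟩ʳ_) k≡j) σj≡K)))

    block-above : ∀ {j y} → σ ⟨$⟩ʳ j ≡ suc K → T (sameBlock SP j y) → K Fin.< σ ⟨$⟩ʳ y
    block-above {j} {y} σj≡K+1 same with toℕ j ℕ.≤? toℕ y
    ... | yes j≤y =
      subst (ℕ._≤ toℕ (σ ⟨$⟩ʳ y)) (cong toℕ σj≡K+1) (block-monotone {σ} maps same j≤y)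
    ... | no j≰y with sameBlock-left⇒root (ℕ.≰⇒> j≰y) same
    ...   | t , refl , t∈SP = ⊥-elim (K∉σS (image-of-root {σ} maps t∈SP σt≡K))
      where
      σt≡K : σ ⟨$⟩ʳ inject₁ t ≡ inject₁ K
      σt≡K = toℕ-injective (ℕ.suc-injective
        (trans (sym (maps t t∈SP)) (trans (cong toℕ σj≡K+1) (cong suc (sym (toℕ-inject₁ K))))))

module _ {m} (SP : StdParabolic m) (μ : Weight (suc m)) (i : Fin (suc m)) where

  private
    blockSum : ℤ
    blockSum = Σℤ (suc m) (λ y → if sameBlock SP i y then μ y else + 0)

    blockSize : ℕ
    blockSize = countℕ (suc m) (sameBlock SP i)

    blockSize-pos : suc (pred blockSize) ≡ blockSize
    blockSize-pos = countℕ-pos (suc m) (sameBlock SP i) i (sameBlock-refl SP i)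

  avgP-≥ : ∀ a → (∀ y → T (sameBlock SP i y) → a ≤ μ y) → mkℚᵘ a 0 ≤ℚ avgP SP μ i
  avgP-≥ a a≤μ = *≤* (begin
    a * + suc (pred blockSize)  ≡⟨ cong (λ n → a * + n) blockSize-pos ⟩
    a * + blockSize             ≤⟨ Σ-if-≥ (suc m) (sameBlock SP i) μ a a≤μ ⟩
    blockSum                    ≡⟨ *-identityʳ blockSum ⟨
    blockSum * + 1              ∎)
    where open ≤-Reasoning

  avgP-≤ : ∀ b → (∀ y → T (sameBlock SP i y) → μ y ≤ b) → avgP SP μ i ≤ℚ mkℚᵘ b 0
  avgP-≤ b μ≤b = *≤* (begin
    blockSum * + 1              ≡⟨ *-identityʳ blockSum ⟩
    blockSum                    ≤⟨ Σ-if-≤ (suc m) (sameBlock SP i) μ b μ≤b ⟩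
    b * + blockSize             ≡⟨ cong (λ n → b * + n) blockSize-pos ⟨
    b * + suc (pred blockSize)  ∎)
    where open ≤-Reasoning

dominant⇒antitone : ∀ {m} {ν : Fin (suc m) → ℚᵘ} → Dominant ν → ∀ {i j} → i Fin.≤ j → ν j ≤ℚ ν i
dominant⇒antitone {ν = ν} dominant i≤j =
  stepwise {R = λ a b → ν b ≤ℚ ν a} ℚ.≤-refl (λ b≤a c≤b → ℚ.≤-trans c≤b b≤a) i≤j
    (λ k _ _ → dominant k)

module Uniqueness {m f : ℕ} (1≤f : 1 ℕ.≤ f) (SP : StdParabolic m) (μ : Weight (suc m))
  (S : Fin f → Fin m → Subset (suc m)) (∣S∣ : ∀ j l → ∣ S j l ∣ ≡ suc (toℕ l))
  (μ≡ : ∀ x → μ x ≡ Σℤ f (λ j → Σℤ m (λ l → eSet (S j l) x)))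
  (w w′ : Weyl (suc m)) (maps : MapsIntoSimple w SP) (maps′ : MapsIntoSimple w′ SP)
  (c : Fin m → ℤ) (expansion : RootExpansion f w′ μ c)
  (P≡wP : ∀ k → InPC SP w′ c k ⇔ InImage w SP k) where

  open RootImage SP using (InImage?; module SameImage)
  open SameImage w w′ maps maps′ c P≡wP using (c≡0)
  open WeightSeparation μ S ∣S∣ μ≡ w′ c expansion

  λ′ = avgP SP μ

  block-gap : ∀ K → ¬ InImage w′ SP K → λ′ (w′ ⟨$⟩ˡ suc K) <ℚ λ′ (w′ ⟨$⟩ˡ inject₁ K)
  block-gap K K∉w′S = ℚ.≤-<-trans λ′-above (ℚ.<-≤-trans gap λ′-below)
    where
    open BlockImages SP w′ maps′ K K∉w′S
    cK≡0 : c K ≡ + 0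
    cK≡0 = c≡0 K K∉w′S
    λ′-above : λ′ (w′ ⟨$⟩ˡ suc K) ≤ℚ mkℚᵘ (upperBound K) 0
    λ′-above = avgP-≤ SP μ (w′ ⟨$⟩ˡ suc K) (upperBound K) λ y same →
      μ≤upperBound cK≡0 y (block-above {w′ ⟨$⟩ˡ suc K} (inverseʳ w′) same)
    λ′-below : mkℚᵘ (lowerBound K) 0 ≤ℚ λ′ (w′ ⟨$⟩ˡ inject₁ K)
    λ′-below = avgP-≥ SP μ (w′ ⟨$⟩ˡ inject₁ K) (lowerBound K) λ y same →
      lowerBound≤μ cK≡0 y (block-below {w′ ⟨$⟩ˡ inject₁ K} (inverseʳ w′) same)
    gap : mkℚᵘ (upperBound K) 0 <ℚ mkℚᵘ (lowerBound K) 0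
    gap = *<* (subst₂ _<_ (sym (*-identityʳ _)) (sym (*-identityʳ _))
                          (upperBound<lowerBound (fromℕ< 1≤f) K))

  increasing : ∀ {v} → InWC SP μ v → ∀ K →
               v ⟨$⟩ʳ (w′ ⟨$⟩ˡ inject₁ K) Fin.< v ⟨$⟩ʳ (w′ ⟨$⟩ˡ suc K)
  increasing {v} (maps-v , dominant-v) K with InImage? {w′} maps′ K
  ... | yes (k , k∈SP , w′k≡K , w′k+1≡K+1) =
    subst₂ (λ a b → v ⟨$⟩ʳ a Fin.< v ⟨$⟩ʳ b) (w′⁻¹ w′k≡K) (w′⁻¹ w′k+1≡K+1)
           (ℕ.≤-reflexive (sym (maps-v k k∈SP)))
    where
    w′⁻¹ : ∀ {a b} → w′ ⟨$⟩ʳ a ≡ b → a ≡ w′ ⟨$⟩ˡ b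
    w′⁻¹ refl = sym (inverseˡ w′)
  ... | no K∉w′S = ℕ.≰⇒> (ℚ.<⇒≱ (block-gap K K∉w′S) ∘ λ′-antitone)
    where
    λ′-antitone : ∀ {a b} → v ⟨$⟩ʳ a Fin.≤ v ⟨$⟩ʳ b → λ′ b ≤ℚ λ′ a
    λ′-antitone a≤b = subst₂ _≤ℚ_ (cong λ′ (inverseˡ v)) (cong λ′ (inverseˡ v))
                                 (dominant⇒antitone {ν = act v λ′} dominant-v a≤b)

  unique : ∀ {v} → InWC SP μ v → ∀ i → v ⟨$⟩ʳ i ≡ w′ ⟨$⟩ʳ i
  unique {v} inWC i = trans (cong (v ⟨$⟩ʳ_) (sym (inverseˡ w′)))
    (adjacent-increasing⇒id (λ p → v ⟨$⟩ʳ (w′ ⟨$⟩ˡ p)) (increasing {v} inWC) (w′ ⟨$⟩ʳ i))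

lemma2p2p3p1 : (m f : ℕ) → 1 ℕ.≤ f → (SP : StdParabolic m) → (μ : Weight (suc m))
    → IsWeightL f μ
    → (w w′ : Weyl (suc m)) → InWC SP μ w → InWC SP μ w′
    → (c : Fin m → ℤ) → RootExpansion f w′ μ c
    → (∀ k → InPC SP w′ c k ⇔ InImage w SP k)
    → Σ (Weyl (suc m)) (λ u → InWC SP μ u
    × ((v : Weyl (suc m)) → InWC SP μ v → ∀ i → v ⟨$⟩ʳ i ≡ u ⟨$⟩ʳ i))
lemma2p2p3p1 m f 1≤f SP μ (S , ∣S∣ , μ≡) w w′ (maps , _) inWC′ c expansion P≡wP =
  w′ , inWC′ , λ v inWC → unique {v} inWC
  where open Uniqueness 1≤f SP μ S ∣S∣ μ≡ w w′ maps (proj₁ inWC′) c expansion P≡wP
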